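{- Let $G=(V,E)$ be a finite simple graph, $V=\{1,\dots,n\}$. Define, for $A\subseteq V$, $\partial_{\mathrm{ext}}A=\{j\in V\setminus A:\{j,i\}\in E\text{ for some }i\in A\}$, $\partial_{\mathrm{int}}A=\{i\in A:\{i,j\}\in E\text{ for some }j\in V\setminus A\}$, $\partial_{\mathrm{ver}}A=\partial_{\mathrm{ext}}A\cup\partial_{\mathrm{int}}A$, and for $\ast\in\{\mathrm{ext},\mathrm{int},\mathrm{ver}\}$ $$h_\ast(G)=\min_{A\in\mathcal P(V)\setminus\{\varnothing,V\}}\frac{\#\partial_\ast A}{\min\{\#A,\#(V\setminus A)\}}.$$ Let $P^1(G)=\inf_{\vec x\ne\vec0,\ \langle\vec x,\vec 1\rangle=0}\frac{\sum_{i\in V}\max_{j\sim i}|x_i-x_j|}{\|\vec x\|_1}$. Then $$\tfrac12\max\{h_{\mathrm{int}}(G),h_{\mathrm{ext}}(G)\}\le P^1(G)\le h_{\mathrm{ver}}(G).$$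
   Context: $j\sim i$ means $\{i,j\}\in E$; $\vec 1$ is the all-ones vector and $\|\cdot\|_1$ the $\ell^1$-norm.
   Formalization: The vectors $\vec x$ in the lower bound have rational entries, and the vectors approaching the infimum in the upper bound are likewise taken in ℚ^n. -}

module Defs where

open import Data.Bool using (Bool; true; false; not; _∧_; _∨_; if_then_else_)
open import Data.Nat as ℕ using (ℕ; zero; suc)
open import Data.Fin using (Fin)
open import Data.List as List using (List; []; _∷_; map; foldr; allFin; filter; _++_)
open import Data.Vec using (Vec; []; _∷_; lookup)
open import Data.Integer using (+_)
open import Data.Rational using (ℚ; 0ℚ; _+_; _-_; _*_; _/_; _⊓_; _⊔_; ∣_∣)
open import Relation.Binary.PropositionalEquality using (_≡_)
open import Data.Bool.ListAction using (any)

record Graph (n : ℕ) : Set where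
  field
    adj       : Fin n → Fin n → Bool
    adj-sym   : ∀ i j → adj i j ≡ adj j i
    adj-irrefl : ∀ i → adj i i ≡ false
open Graph public

-- Subsets of V as characteristic vectors.
VSet : ℕ → Set
VSet n = Vec Bool n

allSubsets : (n : ℕ) → List (VSet n)
allSubsets zero = [] ∷ []
allSubsets (suc n) = map (true ∷_) (allSubsets n) ++ map (false ∷_) (allSubsets n)

anyV : {n : ℕ} → (Fin n → Bool) → Bool
anyV {n} p = any p (allFin n)

card : {n : ℕ} → (Fin n → Bool) → ℕ
card {n} p = List.length (filter (λ i → Data.Bool._≟_ (p i) true) (allFin n))
  where import Data.Bool

∂ext : {n : ℕ} → Graph n → VSet n → Fin n → Bool
∂ext G A j = not (lookup A j) ∧ anyV (λ i → lookup A i ∧ adj G j i)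

∂int : {n : ℕ} → Graph n → VSet n → Fin n → Bool
∂int G A i = lookup A i ∧ anyV (λ j → not (lookup A j) ∧ adj G i j)

∂ver : {n : ℕ} → Graph n → VSet n → Fin n → Bool
∂ver G A i = ∂ext G A i ∨ ∂int G A i

-- a / d as a rational; the d = 0 branch is never used (denominators
-- below are ≥ 1 for nonempty proper subsets).
frac : ℕ → ℕ → ℚ
frac a zero = 0ℚ
frac a (suc d) = (+ a) / suc d

properNonempty : {n : ℕ} → VSet n → Bool
properNonempty A = anyV (lookup A) ∧ anyV (λ i → not (lookup A i))

-- minimum of a list of rationals (seed returned for the empty list)
minList : ℚ → List ℚ → ℚ
minList d [] = d
minList d (q ∷ qs) = foldr _⊓_ q qs

cheeger : {n : ℕ} → (VSet n → Fin n → Bool) → ℚ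
cheeger {n} ∂ =
  minList 0ℚ
    (map (λ A → frac (card (∂ A)) (ℕ._⊓_ (card (lookup A)) (card (λ i → not (lookup A i)))))
         (filter (λ A → Data.Bool._≟_ (properNonempty A) true) (allSubsets n)))
  where import Data.Bool

h-ext h-int h-ver : {n : ℕ} → Graph n → ℚ
h-ext G = cheeger (∂ext G)
h-int G = cheeger (∂int G)
h-ver G = cheeger (∂ver G)

Σ : {n : ℕ} → (Fin n → ℚ) → ℚ
Σ {n} f = foldr _+_ 0ℚ (map f (allFin n))

-- max_{j ~ i} |x_i - x_j|  (= 0 if i is isolated)
maxNbr : {n : ℕ} → Graph n → (Fin n → ℚ) → Fin n → ℚ
maxNbr {n} G x i =
  foldr _⊔_ 0ℚ (map (λ j → if adj G i j then ∣ x i - x j ∣ else 0ℚ) (allFin n))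

P1num : {n : ℕ} → Graph n → (Fin n → ℚ) → ℚ
P1num G x = Σ (maxNbr G x)

norm1 : {n : ℕ} → (Fin n → ℚ) → ℚ
norm1 x = Σ (λ i → ∣ x i ∣)

inner1 : {n : ℕ} → (Fin n → ℚ) → ℚ
inner1 x = Σ x

module Submission where

-- Complementation swaps ∂ext and ∂int and preserves min{#A, #(V∖A)}, so h_ext = h_int and the
-- lower bound only has to be shown for h_int. Let descent x i = max_{j∼i} (x_i − x_j)⁺, which is
-- at most max_{j∼i} |x_i − x_j|. Lowering the top level set A = {x = max x} to the next value M′
-- decreases Σ_i descent x i by at least (M − M′)·#∂int A ≥ (M − M′)·h_int·min{#A, #(V∖A)}, while
-- the spread Σ_i |x_i − c|, suitably recentred, decreases by at most (M − M′)·min{#A, #(V∖A)}.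
-- Iterating until x is constant gives h_int·Σ_i |x_i − c| ≤ Σ_i descent x i for some c, and
-- ‖x‖₁ ≤ 2·Σ_i |x_i − c| when ⟨x, 1⟩ = 0. For the upper bound, if A attains h_ver, the vector
-- equal to #(V∖A) on A and to −#A off A has mean zero, ℓ¹-norm 2·#A·#(V∖A), and P¹-numerator at
-- most (#A + #(V∖A))·#∂ver A ≤ h_ver·2·#A·#(V∖A).

open import Defs

module _ where
  open import Data.Bool using (Bool; true; false; not; _∧_; _∨_; if_then_else_)
  open import Data.Bool.ListAction using (or)
  import Data.Bool as Bool
  open import Data.Bool.Properties
    using (not-involutive; not-injective; ∧-comm; ∧-conicalˡ; ∧-conicalʳ; ∨-zeroʳ; if-float; T-≡)
  open import Data.Fin using (Fin)
  open import Data.Fin.Properties using (any?)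
  import Data.Integer as ℤ
  import Data.Integer.Tactic.RingSolver as ℤ-Solver
  open import Data.List using (List; []; _∷_; map; foldr; filter; length; allFin)
  open import Data.List.Membership.Propositional using (_∈_; lose)
  open import Data.List.Membership.Propositional.Properties
    using (∈-allFin; ∈-map⁺; ∈-map⁻; ∈-filter⁺; ∈-filter⁻; ∈-++⁺ˡ; ∈-++⁺ʳ; foldr-selective)
  open import Data.List.Properties using (filter-some; map-cong)
  open import Data.Rational.Properties
  open import Relation.Binary.Bundles using (DecTotalOrder)
  open import Data.List.Extrema (DecTotalOrder.totalOrder ≤-decTotalOrder)
    using (argmax; argmax-all; f[xs]≤f[argmax])
  open import Data.List.Relation.Unary.All as All using ()
  open import Data.List.Relation.Unary.All.Properties using (all-filter)
  open import Data.List.Relation.Unary.Any using (here; there; satisfied)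
  open import Data.List.Relation.Unary.Any.Properties using (any⁺; any⁻)
  open import Data.Nat as ℕ using (ℕ; zero; suc; s≤s; z≤n)
  open import Data.Nat.Induction using (<-wellFounded)
  import Data.Nat.Properties as ℕₚ
  open import Data.Product using (Σ-syntax; ∃-syntax; _×_; _,_; proj₁; proj₂)
  open import Data.Rational
    using (ℚ; 0ℚ; 1ℚ; ½; _+_; _-_; -_; _*_; _⊓_; _⊔_; ∣_∣; _≤_; _<_; toℚᵘ; nonNegative)
  import Data.Rational.Unnormalised as ℚᵘ
  import Data.Rational.Unnormalised.Properties as ℚᵘₚ
  open import Data.Sum using (_⊎_; inj₁; inj₂)
  open import Data.Unit using (tt)
  open import Data.Vec using (Vec; lookup; tabulate; replicate)
  import Data.Vec as Vec
  open import Data.Vec.Properties using (lookup-map; lookup∘tabulate)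
  open import Function.Bundles using (Equivalence)
  open import Induction.WellFounded using (Acc; acc)
  open import Relation.Binary.PropositionalEquality
  open import Relation.Nullary using (Dec; yes; no; ¬_; does; contradiction)
  open import Relation.Nullary.Decidable using (dec-true; dec-false; dec⇒maybe)
  open import Relation.Unary using (Pred; Decidable)
  open import Tactic.RingSolver using (solve-∀; solve)
  open import Tactic.RingSolver.Core.AlmostCommutativeRing
    using (AlmostCommutativeRing; fromCommutativeRing)
  open Equivalence using (to; from)

  ℚ-ring : AlmostCommutativeRing _ _
  ℚ-ring = fromCommutativeRing +-*-commutativeRing (λ p → dec⇒maybe (0ℚ ≟ p))

  p≤q⇒0≤q-p : ∀ {p q} → p ≤ q → 0ℚ ≤ q - p
  p≤q⇒0≤q-p {p} {q} p≤q = begin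
    0ℚ     ≡⟨ +-inverseʳ p ⟨
    p - p  ≤⟨ +-monoˡ-≤ (- p) p≤q ⟩
    q - p  ∎
    where open ≤-Reasoning

  p+q≤r⇒p≤r-q : ∀ {p q r} → p + q ≤ r → p ≤ r - q
  p+q≤r⇒p≤r-q {p} {q} {r} p+q≤r = begin
    p            ≡⟨ solve (p ∷ q ∷ []) ℚ-ring ⟨
    p + q - q    ≤⟨ +-monoˡ-≤ (- q) p+q≤r ⟩
    r - q        ∎
    where open ≤-Reasoning

  p≤r-q⇒p+q≤r : ∀ {p q r} → p ≤ r - q → p + q ≤ r
  p≤r-q⇒p+q≤r {p} {q} {r} p≤r-q = begin
    p + q        ≤⟨ +-monoˡ-≤ q p≤r-q ⟩
    r - q + q    ≡⟨ solve (r ∷ q ∷ []) ℚ-ring ⟩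
    r            ∎
    where open ≤-Reasoning

  *-monoˡ-≤-0≤ : ∀ {r p q} → 0ℚ ≤ r → p ≤ q → r * p ≤ r * q
  *-monoˡ-≤-0≤ {r} 0≤r = *-monoˡ-≤-nonNeg r {{nonNegative 0≤r}}

  *-monoʳ-≤-0≤ : ∀ {r p q} → 0ℚ ≤ r → p ≤ q → p * r ≤ q * r
  *-monoʳ-≤-0≤ {r} 0≤r = *-monoʳ-≤-nonNeg r {{nonNegative 0≤r}}

  p≤∣p∣ : ∀ p → p ≤ ∣ p ∣
  p≤∣p∣ p with ≤-total 0ℚ p
  ... | inj₁ 0≤p = ≤-reflexive (sym (0≤p⇒∣p∣≡p 0≤p))
  ... | inj₂ p≤0 = ≤-trans p≤0 (0≤∣p∣ p)

  ∣p-q∣≡∣q-p∣ : ∀ p q → ∣ p - q ∣ ≡ ∣ q - p ∣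
  ∣p-q∣≡∣q-p∣ p q = begin
    ∣ p - q ∣        ≡⟨ ∣-p∣≡∣p∣ (p - q) ⟨
    ∣ - (p - q) ∣    ≡⟨ cong ∣_∣ (solve (p ∷ q ∷ []) ℚ-ring) ⟩
    ∣ q - p ∣        ∎
    where open ≡-Reasoning

  ∣p-q∣≡q-p : ∀ {p q} → p ≤ q → ∣ p - q ∣ ≡ q - p
  ∣p-q∣≡q-p {p} {q} p≤q = trans (∣p-q∣≡∣q-p∣ p q) (0≤p⇒∣p∣≡p (p≤q⇒0≤q-p p≤q))

  ∣p-p∣≡0 : ∀ p → ∣ p - p ∣ ≡ 0ℚ
  ∣p-p∣≡0 p = cong ∣_∣ (+-inverseʳ p)

  ∣p-r∣≤∣p-q∣+∣q-r∣ : ∀ p q r → ∣ p - r ∣ ≤ ∣ p - q ∣ + ∣ q - r ∣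
  ∣p-r∣≤∣p-q∣+∣q-r∣ p q r = begin
    ∣ p - r ∣                ≡⟨ cong ∣_∣ (solve (p ∷ q ∷ r ∷ []) ℚ-ring) ⟩
    ∣ (p - q) + (q - r) ∣    ≤⟨ ∣p+q∣≤∣p∣+∣q∣ (p - q) (q - r) ⟩
    ∣ p - q ∣ + ∣ q - r ∣    ∎
    where open ≤-Reasoning

  p-q⊓r≡p-q⊔p-r : ∀ p q r → p - (q ⊓ r) ≡ (p - q) ⊔ (p - r)
  p-q⊓r≡p-q⊔p-r p = antimono-≤-distrib-⊓ (λ q≤r → +-monoʳ-≤ p (neg-antimono-≤ q≤r))

  +-interchange : ∀ p q r s → (p + q) + (r + s) ≡ (p + r) + (q + s)
  +-interchange = solve-∀ ℚ-ring

  *-suc : ∀ p q → p + p * q ≡ p * (1ℚ + q)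
  *-suc = solve-∀ ℚ-ring

  q-r+[p-q]≡p-r : ∀ p q r → q - r + (p - q) ≡ p - r
  q-r+[p-q]≡p-r = solve-∀ ℚ-ring

  -p*q+p*r≡p*[r-q] : ∀ p q r → - p * q + p * r ≡ p * (r - q)
  -p*q+p*r≡p*[r-q] = solve-∀ ℚ-ring

  p*[q+r*s]≡p*q+r*[p*s] : ∀ p q r s → p * (q + r * s) ≡ p * q + r * (p * s)
  p*[q+r*s]≡p*q+r*[p*s] = solve-∀ ℚ-ring

  ½*p*[q+q]≡p*q : ∀ p q → ½ * p * (q + q) ≡ p * q
  ½*p*[q+q]≡p*q = solve-∀ ℚ-ring

  0≤p*q : ∀ {p q} → 0ℚ ≤ p → 0ℚ ≤ q → 0ℚ ≤ p * q
  0≤p*q {p} 0≤p 0≤q = ≤-trans (≤-reflexive (sym (*-zeroʳ p))) (*-monoˡ-≤-0≤ 0≤p 0≤q)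

  p*q+-q*p≡0 : ∀ p q → p * q + - q * p ≡ 0ℚ
  p*q+-q*p≡0 = solve-∀ ℚ-ring

  p--q≡p+q : ∀ p q → p - - q ≡ p + q
  p--q≡p+q = solve-∀ ℚ-ring

  p≤h*q⇒p≤[h+ε]*q : ∀ h {p q ε} → 0ℚ ≤ q → 0ℚ < ε → p ≤ h * q → p ≤ (h + ε) * q
  p≤h*q⇒p≤[h+ε]*q h {p} {q} {ε} 0≤q 0<ε p≤h*q = begin
    p                ≤⟨ p≤h*q ⟩
    h * q            ≡⟨ +-identityʳ (h * q) ⟨
    h * q + 0ℚ       ≤⟨ +-monoʳ-≤ (h * q) (0≤p*q (<⇒≤ 0<ε) 0≤q) ⟩
    h * q + ε * q    ≡⟨ *-distribʳ-+ q h ε ⟨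
    (h + ε) * q      ∎
    where open ≤-Reasoning

  fromℕ : ℕ → ℚ
  fromℕ zero = 0ℚ
  fromℕ (suc m) = 1ℚ + fromℕ m

  fromℕ-+ : ∀ m k → fromℕ (m ℕ.+ k) ≡ fromℕ m + fromℕ k
  fromℕ-+ zero k = sym (+-identityˡ (fromℕ k))
  fromℕ-+ (suc m) k = trans (cong (1ℚ +_) (fromℕ-+ m k)) (sym (+-assoc 1ℚ (fromℕ m) (fromℕ k)))

  0≤fromℕ : ∀ m → 0ℚ ≤ fromℕ m
  0≤fromℕ zero = ≤-refl
  0≤fromℕ (suc m) = +-mono-≤ (nonNegative⁻¹ 1ℚ) (0≤fromℕ m)

  0<fromℕ : ∀ {m} → 1 ℕ.≤ m → 0ℚ < fromℕ m
  0<fromℕ {suc m} _ = +-mono-<-≤ (positive⁻¹ 1ℚ) (0≤fromℕ m)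

  fromℕ-mono-≤ : ∀ {m k} → m ℕ.≤ k → fromℕ m ≤ fromℕ k
  fromℕ-mono-≤ {m} {k} m≤k = begin
    fromℕ m                    ≡⟨ +-identityʳ (fromℕ m) ⟨
    fromℕ m + 0ℚ               ≤⟨ +-monoʳ-≤ (fromℕ m) (0≤fromℕ (k ℕ.∸ m)) ⟩
    fromℕ m + fromℕ (k ℕ.∸ m)  ≡⟨ fromℕ-+ m (k ℕ.∸ m) ⟨
    fromℕ (m ℕ.+ (k ℕ.∸ m))    ≡⟨ cong fromℕ (ℕₚ.m+[n∸m]≡n m≤k) ⟩
    fromℕ k                    ∎
    where open ≤-Reasoning

  toℚᵘ-fromℕ : ∀ m → toℚᵘ (fromℕ m) ℚᵘ.≃ ℚᵘ.mkℚᵘ (ℤ.+ m) 0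
  toℚᵘ-fromℕ zero = ℚᵘ.*≡* refl
  toℚᵘ-fromℕ (suc m) = ℚᵘₚ.≃-trans (toℚᵘ-homo-+ 1ℚ (fromℕ m))
    (ℚᵘₚ.≃-trans (ℚᵘₚ.+-congʳ (toℚᵘ 1ℚ) (toℚᵘ-fromℕ m)) (ℚᵘ.*≡* (ℤ-identity (ℤ.+ m))))
    where
    ℤ-identity : ∀ a → (ℤ.1ℤ ℤ.* ℤ.1ℤ ℤ.+ a ℤ.* ℤ.1ℤ) ℤ.* ℤ.1ℤ ≡ (ℤ.1ℤ ℤ.+ a) ℤ.* (ℤ.1ℤ ℤ.* ℤ.1ℤ)
    ℤ-identity = ℤ-Solver.solve-∀

  0≤frac : ∀ m d → 0ℚ ≤ frac m d
  0≤frac m zero = ≤-refl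
  0≤frac m (suc d) = nonNegative⁻¹ _ {{normalize-nonNeg m (suc d)}}

  frac-* : ∀ m {d} → 1 ℕ.≤ d → frac m d * fromℕ d ≡ fromℕ m
  frac-* m {suc d} _ = toℚᵘ-injective (ℚᵘₚ.≃-trans (toℚᵘ-homo-* (frac m (suc d)) (fromℕ (suc d)))
    (ℚᵘₚ.≃-trans (ℚᵘₚ.*-cong (toℚᵘ-fromℚᵘ (ℚᵘ.mkℚᵘ (ℤ.+ m) d)) (toℚᵘ-fromℕ (suc d)))
      (ℚᵘₚ.≃-trans (ℚᵘ.*≡* (ℤ-identity (ℤ.+ m) (ℤ.+ d))) (ℚᵘₚ.≃-sym (toℚᵘ-fromℕ m)))))
    where
    ℤ-identity : ∀ a b → (a ℤ.* (ℤ.1ℤ ℤ.+ b)) ℤ.* ℤ.1ℤ ≡ a ℤ.* ((ℤ.1ℤ ℤ.+ b) ℤ.* ℤ.1ℤ)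
    ℤ-identity = ℤ-Solver.solve-∀

  module _ {A : Set} where

    sumMap : List A → (A → ℚ) → ℚ
    sumMap L f = foldr _+_ 0ℚ (map f L)

    maxMap : List A → (A → ℚ) → ℚ
    maxMap L f = foldr _⊔_ 0ℚ (map f L)

    count : List A → (A → Bool) → ℕ
    count L p = length (filter (λ a → p a Bool.≟ true) L)

    sumMap-cong : ∀ L {f g : A → ℚ} → (∀ a → f a ≡ g a) → sumMap L f ≡ sumMap L g
    sumMap-cong [] f≗g = refl
    sumMap-cong (a ∷ L) f≗g = cong₂ _+_ (f≗g a) (sumMap-cong L f≗g)

    sumMap-mono-≤ : ∀ L {f g : A → ℚ} → (∀ a → f a ≤ g a) → sumMap L f ≤ sumMap L g
    sumMap-mono-≤ [] f≤g = ≤-refl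
    sumMap-mono-≤ (a ∷ L) f≤g = +-mono-≤ (f≤g a) (sumMap-mono-≤ L f≤g)

    0≤sumMap : ∀ L {f : A → ℚ} → (∀ a → 0ℚ ≤ f a) → 0ℚ ≤ sumMap L f
    0≤sumMap [] 0≤f = ≤-refl
    0≤sumMap (a ∷ L) 0≤f = +-mono-≤ (0≤f a) (0≤sumMap L 0≤f)

    sumMap-+ : ∀ L (f g : A → ℚ) → sumMap L (λ a → f a + g a) ≡ sumMap L f + sumMap L g
    sumMap-+ [] f g = refl
    sumMap-+ (a ∷ L) f g = trans (cong (f a + g a +_) (sumMap-+ L f g))
      (+-interchange (f a) (g a) (sumMap L f) (sumMap L g))

    sumMap-neg : ∀ L (f : A → ℚ) → sumMap L (λ a → - f a) ≡ - sumMap L f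
    sumMap-neg [] f = refl
    sumMap-neg (a ∷ L) f =
      trans (cong (- f a +_) (sumMap-neg L f)) (sym (neg-distrib-+ (f a) (sumMap L f)))

    sumMap-const : ∀ L c → sumMap L (λ _ → c) ≡ c * fromℕ (length L)
    sumMap-const [] c = sym (*-zeroʳ c)
    sumMap-const (a ∷ L) c = trans (cong (c +_) (sumMap-const L c)) (*-suc c (fromℕ (length L)))

    ∣sumMap∣≤sumMap∣∣ : ∀ L (f : A → ℚ) → ∣ sumMap L f ∣ ≤ sumMap L (λ a → ∣ f a ∣)
    ∣sumMap∣≤sumMap∣∣ [] f = ≤-refl
    ∣sumMap∣≤sumMap∣∣ (a ∷ L) f =
      ≤-trans (∣p+q∣≤∣p∣+∣q∣ (f a) (sumMap L f)) (+-monoʳ-≤ ∣ f a ∣ (∣sumMap∣≤sumMap∣∣ L f))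

    sumMap-indicator : ∀ L (p : A → Bool) d →
                       sumMap L (λ a → if p a then d else 0ℚ) ≡ d * fromℕ (count L p)
    sumMap-indicator [] p d = sym (*-zeroʳ d)
    sumMap-indicator (a ∷ L) p d with p a
    ... | true = trans (cong (d +_) (sumMap-indicator L p d)) (*-suc d (fromℕ (count L p)))
    ... | false = trans (+-identityˡ _) (sumMap-indicator L p d)

    sumMap-+-indicator : ∀ L (f : A → ℚ) p d →
      sumMap L (λ a → f a + (if p a then d else 0ℚ)) ≡ sumMap L f + d * fromℕ (count L p)
    sumMap-+-indicator L f p d =
      trans (sumMap-+ L f _) (cong (sumMap L f +_) (sumMap-indicator L p d))

    0≤maxMap : ∀ L (f : A → ℚ) → 0ℚ ≤ maxMap L f
    0≤maxMap [] f = ≤-refl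
    0≤maxMap (a ∷ L) f = ≤-trans (0≤maxMap L f) (p≤q⊔p (f a) (maxMap L f))

    ≤maxMap : ∀ {L} (f : A → ℚ) {a} → a ∈ L → f a ≤ maxMap L f
    ≤maxMap {b ∷ L} f (here refl) = p≤p⊔q (f b) (maxMap L f)
    ≤maxMap {b ∷ L} f (there a∈L) = ≤-trans (≤maxMap f a∈L) (p≤q⊔p (f b) (maxMap L f))

    maxMap-lub : ∀ L {f : A → ℚ} {c} → 0ℚ ≤ c → (∀ a → f a ≤ c) → maxMap L f ≤ c
    maxMap-lub [] 0≤c f≤c = 0≤c
    maxMap-lub (a ∷ L) 0≤c f≤c = ⊔-lub (f≤c a) (maxMap-lub L 0≤c f≤c)

    count-mono : ∀ L {p q : A → Bool} → (∀ a → p a ≡ true → q a ≡ true) → count L p ℕ.≤ count L q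
    count-mono [] p⇒q = z≤n
    count-mono (a ∷ L) {p} {q} p⇒q with p a in pa | q a in qa
    ... | true  | true  = s≤s (count-mono L p⇒q)
    ... | true  | false = contradiction (trans (sym (p⇒q a pa)) qa) λ ()
    ... | false | true  = ℕₚ.m≤n⇒m≤1+n (count-mono L p⇒q)
    ... | false | false = count-mono L p⇒q

    count-mono-< : ∀ L {p q : A → Bool} → (∀ a → p a ≡ true → q a ≡ true) →
                   ∀ {b} → b ∈ L → p b ≡ false → q b ≡ true → count L p ℕ.< count L q
    count-mono-< (a ∷ L) {p} {q} p⇒q (here refl) pb qb rewrite pb | qb = s≤s (count-mono L p⇒q)
    count-mono-< (a ∷ L) {p} {q} p⇒q (there b∈L) pb qb with p a in pa | q a in qa
    ... | true  | true  = s≤s (count-mono-< L p⇒q b∈L pb qb)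
    ... | true  | false = contradiction (trans (sym (p⇒q a pa)) qa) λ ()
    ... | false | true  = ℕₚ.m≤n⇒m≤1+n (count-mono-< L p⇒q b∈L pb qb)
    ... | false | false = count-mono-< L p⇒q b∈L pb qb

    count-cong : ∀ L {p q : A → Bool} → (∀ a → p a ≡ q a) → count L p ≡ count L q
    count-cong L p≗q = ℕₚ.≤-antisym (count-mono L (λ a → trans (sym (p≗q a))))
                                     (count-mono L (λ a → trans (p≗q a)))

  -- Vertex sets and Cheeger constants

  properSubset : ∀ {n} → 2 ℕ.≤ n → Σ[ A ∈ VSet n ] properNonempty A ≡ true
  properSubset (s≤s (s≤s _)) = true Vec.∷ false Vec.∷ replicate _ false , refl

  module _ {n : ℕ} where

    anyV-intro : ∀ {p : Fin n → Bool} i → p i ≡ true → anyV p ≡ true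
    anyV-intro {p} i pi = to T-≡ (any⁺ p (lose (∈-allFin i) (from T-≡ pi)))

    anyV-witness : ∀ {p : Fin n → Bool} → anyV p ≡ true → ∃[ i ] p i ≡ true
    anyV-witness {p} any≡true with satisfied (any⁻ p (allFin n) (from T-≡ any≡true))
    ... | i , Tpi = i , to T-≡ Tpi

    anyV-cong : ∀ {p q : Fin n → Bool} → (∀ i → p i ≡ q i) → anyV p ≡ anyV q
    anyV-cong p≗q = cong or (map-cong p≗q (allFin n))

    1≤card : ∀ {p : Fin n → Bool} i → p i ≡ true → 1 ℕ.≤ card p
    1≤card {p} i pi = filter-some (λ j → p j Bool.≟ true) (lose (∈-allFin i) pi)

    complement : VSet n → VSet n
    complement = Vec.map not

    minSide : VSet n → ℕ
    minSide A = card (lookup A) ℕ.⊓ card (λ i → not (lookup A i))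

    properNonempty-intro : ∀ (A : VSet n) i j → lookup A i ≡ true → lookup A j ≡ false →
                           properNonempty A ≡ true
    properNonempty-intro A i j Ai Aj = cong₂ _∧_ (anyV-intro i Ai) (anyV-intro j (cong not Aj))

    member : ∀ (A : VSet n) → properNonempty A ≡ true → ∃[ i ] lookup A i ≡ true
    member A pA = anyV-witness (∧-conicalˡ _ _ pA)

    nonMember : ∀ (A : VSet n) → properNonempty A ≡ true → ∃[ j ] lookup A j ≡ false
    nonMember A pA = let j , ¬Aj = anyV-witness (∧-conicalʳ _ _ pA) in j , not-injective ¬Aj

    1≤minSide : ∀ (A : VSet n) → properNonempty A ≡ true → 1 ℕ.≤ minSide A
    1≤minSide A pA =
      let i , Ai = member A pA
          j , Aj = nonMember A pA
      in ℕₚ.⊓-glb (1≤card i Ai) (1≤card {p = λ k → not (lookup A k)} j (cong not Aj))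

    properNonempty-complement : ∀ (A : VSet n) → properNonempty A ≡ true →
                                properNonempty (complement A) ≡ true
    properNonempty-complement A pA = begin
      anyV (lookup (complement A)) ∧ anyV (λ i → not (lookup (complement A) i))
        ≡⟨ cong₂ _∧_ (anyV-cong (λ i → lookup-map i not A))
                     (anyV-cong (λ i → trans (cong not (lookup-map i not A)) (not-involutive _))) ⟩
      anyV (λ i → not (lookup A i)) ∧ anyV (lookup A)
        ≡⟨ ∧-comm (anyV (λ i → not (lookup A i))) (anyV (lookup A)) ⟩
      properNonempty A
        ≡⟨ pA ⟩
      true ∎
      where open ≡-Reasoning

    minSide-complement : ∀ (A : VSet n) → minSide (complement A) ≡ minSide A
    minSide-complement A = trans
      (cong₂ ℕ._⊓_ (count-cong (allFin n) (λ i → lookup-map i not A))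
                   (count-cong (allFin n) (λ i → trans (cong not (lookup-map i not A))
                                                       (not-involutive _))))
      (ℕₚ.⊓-comm _ _)

  allSubsets-complete : ∀ {n} (A : VSet n) → A ∈ allSubsets n
  allSubsets-complete Vec.[] = here refl
  allSubsets-complete (true Vec.∷ A) = ∈-++⁺ˡ (∈-map⁺ (true Vec.∷_) (allSubsets-complete A))
  allSubsets-complete {suc n} (false Vec.∷ A) =
    ∈-++⁺ʳ (map (true Vec.∷_) (allSubsets n)) (∈-map⁺ (false Vec.∷_) (allSubsets-complete A))

  foldr-⊓-≤ : ∀ e qs {q} → q ∈ e ∷ qs → foldr _⊓_ e qs ≤ q
  foldr-⊓-≤ e []       (here refl)         = ≤-refl
  foldr-⊓-≤ e (r ∷ qs) (here refl)         = ≤-trans (p⊓q≤q r _) (foldr-⊓-≤ e qs (here refl))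
  foldr-⊓-≤ e (r ∷ qs) (there (here refl)) = p⊓q≤p r _
  foldr-⊓-≤ e (r ∷ qs) (there (there q∈))  = ≤-trans (p⊓q≤q r _) (foldr-⊓-≤ e qs (there q∈))

  minList-≤ : ∀ d qs {q} → q ∈ qs → minList d qs ≤ q
  minList-≤ d (q ∷ qs) = foldr-⊓-≤ q qs

  minList-∈ : ∀ d qs {q} → q ∈ qs → minList d qs ∈ qs
  minList-∈ d (q ∷ qs) _ with foldr-selective ⊓-sel q qs
  ... | inj₁ min≡q = here min≡q
  ... | inj₂ min∈qs = there min∈qs

  module _ {n : ℕ} (∂ : VSet n → Fin n → Bool) where

    ratio : VSet n → ℚ
    ratio A = frac (card (∂ A)) (minSide A)

    private
      proper? : (A : VSet n) → Dec (properNonempty A ≡ true)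
      proper? A = properNonempty A Bool.≟ true

      proper∈ : ∀ A → properNonempty A ≡ true → A ∈ filter proper? (allSubsets n)
      proper∈ A = ∈-filter⁺ proper? (allSubsets-complete A)

    cheeger-≤ : ∀ A → properNonempty A ≡ true → cheeger ∂ ≤ ratio A
    cheeger-≤ A pA = minList-≤ 0ℚ _ (∈-map⁺ ratio (proper∈ A pA))

    cheeger-attained : ∀ A → properNonempty A ≡ true →
                       Σ[ B ∈ VSet n ] properNonempty B ≡ true × cheeger ∂ ≡ ratio B
    cheeger-attained A pA =
      let B , B∈ , cheeger≡ = ∈-map⁻ ratio (minList-∈ 0ℚ _ (∈-map⁺ ratio (proper∈ A pA)))
      in B , proj₂ (∈-filter⁻ proper? {xs = allSubsets n} B∈) , cheeger≡

    0≤cheeger : ∀ A → properNonempty A ≡ true → 0ℚ ≤ cheeger ∂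
    0≤cheeger A pA =
      let B , _ , cheeger≡ = cheeger-attained A pA
      in ≤-trans (0≤frac (card (∂ B)) (minSide B)) (≤-reflexive (sym cheeger≡))

    cheeger-isoperimetric : ∀ A → properNonempty A ≡ true →
                            cheeger ∂ * fromℕ (minSide A) ≤ fromℕ (card (∂ A))
    cheeger-isoperimetric A pA = begin
      cheeger ∂ * fromℕ (minSide A)  ≤⟨ *-monoʳ-≤-0≤ (0≤fromℕ (minSide A)) (cheeger-≤ A pA) ⟩
      ratio A * fromℕ (minSide A)    ≡⟨ frac-* (card (∂ A)) (1≤minSide A pA) ⟩
      fromℕ (card (∂ A))             ∎
      where open ≤-Reasoning

  module _ {n : ℕ} (G : Graph n) where

    ∂ext-complement : ∀ A i → ∂ext G (complement A) i ≡ ∂int G A i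
    ∂ext-complement A i =
      cong₂ _∧_ (trans (cong not (lookup-map i not A)) (not-involutive (lookup A i)))
                (anyV-cong (λ j → cong (_∧ adj G i j) (lookup-map j not A)))

    h-ext≤h-int : ∀ A → properNonempty A ≡ true → h-ext G ≤ h-int G
    h-ext≤h-int A pA =
      let B , pB , h-int≡ = cheeger-attained (∂int G) A pA
      in begin
        h-ext G                         ≤⟨ cheeger-≤ (∂ext G) (complement B)
                                                     (properNonempty-complement B pB) ⟩
        ratio (∂ext G) (complement B)   ≡⟨ cong₂ frac (count-cong (allFin n) (∂ext-complement B))
                                                      (minSide-complement B) ⟩
        ratio (∂int G) B                ≡⟨ h-int≡ ⟨
        h-int G                         ∎
      where open ≤-Reasoning

  -- Top level sets and the descent of a vector

  does-true⇒ : ∀ {P : Set} (P? : Dec P) → does P? ≡ true → P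
  does-true⇒ (yes p) _ = p

  does-false⇒ : ∀ {P : Set} (P? : Dec P) → does P? ≡ false → ¬ P
  does-false⇒ (no ¬p) _ = ¬p

  record TopLevelSet {n} (x : Fin n → ℚ) (A : VSet n) (M M' : ℚ) : Set where
    field
      gap    : M' ≤ M
      on-top : ∀ j → lookup A j ≡ true → x j ≡ M
      below  : ∀ j → lookup A j ≡ false → x j ≤ M'

  module _ {n : ℕ} where

    maximiser : ∀ (x : Fin n → ℚ) {ℓ} {P : Pred (Fin n) ℓ} → Decidable P → ∀ {j} → P j →
                Σ[ k ∈ Fin n ] P k × (∀ i → P i → x i ≤ x k)
    maximiser x P? {j} Pj = k , argmax-all x Pj (all-filter P? (allFin n)) , bound
      where
      candidates = filter P? (allFin n)
      k = argmax x j candidates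
      bound : ∀ i → _ → x i ≤ x k
      bound i Pi = All.lookup (f[xs]≤f[argmax] {f = x} j candidates) (∈-filter⁺ P? (∈-allFin i) Pi)

    upperSet : (Fin n → ℚ) → ℚ → VSet n
    upperSet x M = tabulate (λ i → does (M ≤? x i))

    upperSet-topLevelSet : ∀ (x : Fin n → ℚ) {M M'} → (∀ i → x i ≤ M) → M' ≤ M →
                           (∀ i → x i < M → x i ≤ M') → TopLevelSet x (upperSet x M) M M'
    upperSet-topLevelSet x {M} x≤M M'≤M below = record
      { gap    = M'≤M
      ; on-top = λ i i∈A → ≤-antisym (x≤M i) (does-true⇒ (M ≤? x i) (trans (sym (A-lookup i)) i∈A))
      ; below  = λ i i∉A → below i (≰⇒> (does-false⇒ (M ≤? x i) (trans (sym (A-lookup i)) i∉A)))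
      }
      where A-lookup = lookup∘tabulate (λ i → does (M ≤? x i))

    upperSet-proper : ∀ (x : Fin n → ℚ) {M} k j → x k ≡ M → x j < M →
                      properNonempty (upperSet x M) ≡ true
    upperSet-proper x {M} k j xk≡M xj<M = properNonempty-intro (upperSet x M) k j
      (trans (A-lookup k) (dec-true (M ≤? x k) (≤-reflexive (sym xk≡M))))
      (trans (A-lookup j) (dec-false (M ≤? x j) (λ M≤xj → <-irrefl refl (<-≤-trans xj<M M≤xj))))
      where A-lookup = lookup∘tabulate (λ i → does (M ≤? x i))

    truncate-fewer-below : ∀ (x : Fin n → ℚ) {M M'} k → x k ≡ M' → M' < M →
      card (λ i → does (x i ⊓ M' <? M')) ℕ.< card (λ i → does (x i <? M))
    truncate-fewer-below x {M} {M'} k xk≡M' M'<M =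
      count-mono-< (allFin n) {λ i → does (x i ⊓ M' <? M')} {λ i → does (x i <? M)}
                   y<M'⇒x<M (∈-allFin k)
      (dec-false (x k ⊓ M' <? M') (<-irrefl (trans (cong (_⊓ M') xk≡M') (⊓-idem M'))))
      (dec-true (x k <? M) (subst (_< M) (sym xk≡M') M'<M))
      where
      y<M'⇒x<M : ∀ i → does (x i ⊓ M' <? M') ≡ true → does (x i <? M) ≡ true
      y<M'⇒x<M i yi<M' = dec-true (x i <? M) (≰⇒> λ M≤xi →
        <-irrefl (p≥q⇒p⊓q≡q (≤-trans (<⇒≤ M'<M) M≤xi)) (does-true⇒ (x i ⊓ M' <? M') yi<M'))

  module _ {n : ℕ} (G : Graph n) where

    nbrMax : Fin n → (Fin n → ℚ) → ℚ
    nbrMax i w = maxMap (allFin n) (λ j → if adj G i j then w j else 0ℚ)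

    0≤nbrMax : ∀ i w → 0ℚ ≤ nbrMax i w
    0≤nbrMax i w = 0≤maxMap (allFin n) _

    ≤nbrMax : ∀ {i j} w → adj G i j ≡ true → w j ≤ nbrMax i w
    ≤nbrMax {i} {j} w i~j = subst (_≤ nbrMax i w) (cong (if_then w j else 0ℚ) i~j)
                                  (≤maxMap (λ k → if adj G i k then w k else 0ℚ) (∈-allFin j))

    nbrMax-lub : ∀ i w {c} → 0ℚ ≤ c → (∀ j → adj G i j ≡ true → w j ≤ c) → nbrMax i w ≤ c
    nbrMax-lub i w {c} 0≤c w≤c = maxMap-lub (allFin n) 0≤c bound
      where
      bound : ∀ j → (if adj G i j then w j else 0ℚ) ≤ c
      bound j with adj G i j in i~j
      ... | true  = w≤c j i~j
      ... | false = 0≤c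

    nbrMax-+-lub : ∀ i w {d c} → d ≤ c → (∀ j → adj G i j ≡ true → w j + d ≤ c) → nbrMax i w + d ≤ c
    nbrMax-+-lub i w d≤c w+d≤c =
      p≤r-q⇒p+q≤r (nbrMax-lub i w (p≤q⇒0≤q-p d≤c) (λ j i~j → p+q≤r⇒p≤r-q (w+d≤c j i~j)))

    descent : (Fin n → ℚ) → Fin n → ℚ
    descent x i = nbrMax i (λ j → x i - x j)

    descent≤maxNbr : ∀ x i → descent x i ≤ maxNbr G x i
    descent≤maxNbr x i = nbrMax-lub i _ (0≤nbrMax i _)
      (λ j i~j → ≤-trans (p≤∣p∣ (x i - x j)) (≤nbrMax (λ k → ∣ x i - x k ∣) i~j))

    descent-⊓ : ∀ x c i → descent (λ j → x j ⊓ c) i ≤ descent x i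
    descent-⊓ x c i = nbrMax-lub i _ (0≤nbrMax i _) bound
      where
      open ≤-Reasoning
      bound : ∀ j → adj G i j ≡ true → x i ⊓ c - x j ⊓ c ≤ descent x i
      bound j i~j with ≤-total (x j) c
      ... | inj₁ xj≤c = begin
        x i ⊓ c - x j ⊓ c  ≡⟨ cong (λ t → x i ⊓ c - t) (p≤q⇒p⊓q≡p xj≤c) ⟩
        x i ⊓ c - x j      ≤⟨ +-monoˡ-≤ (- x j) (p⊓q≤p (x i) c) ⟩
        x i - x j          ≤⟨ ≤nbrMax (λ k → x i - x k) i~j ⟩
        descent x i        ∎
      ... | inj₂ c≤xj = begin
        x i ⊓ c - x j ⊓ c  ≡⟨ cong (λ t → x i ⊓ c - t) (p≥q⇒p⊓q≡q c≤xj) ⟩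
        x i ⊓ c - c        ≤⟨ +-monoˡ-≤ (- c) (p⊓q≤q (x i) c) ⟩
        c - c              ≡⟨ +-inverseʳ c ⟩
        0ℚ                 ≤⟨ 0≤nbrMax i _ ⟩
        descent x i        ∎

    descent-truncate : ∀ {x A M M'} → TopLevelSet x A M M' →
      ∀ i → descent (λ j → x j ⊓ M') i + (if ∂int G A i then M - M' else 0ℚ) ≤ descent x i
    descent-truncate {x} {A} {M} {M'} top i with ∂int G A i in ∂i
    ... | false = ≤-trans (≤-reflexive (+-identityʳ _)) (descent-⊓ x M' i)
    ... | true  = nbrMax-+-lub i _ gap≤descent step
      where
      open ≤-Reasoning
      open TopLevelSet top
      xi≡M : x i ≡ M
      xi≡M = on-top i (∧-conicalˡ _ _ ∂i)
      outside = anyV-witness (∧-conicalʳ _ _ ∂i)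
      k = proj₁ outside
      i~k : adj G i k ≡ true
      i~k = ∧-conicalʳ _ _ (proj₂ outside)
      xk≤M' : x k ≤ M'
      xk≤M' = below k (not-injective (∧-conicalˡ _ _ (proj₂ outside)))
      gap≤descent : M - M' ≤ descent x i
      gap≤descent = begin
        M - M'       ≤⟨ +-monoʳ-≤ M (neg-antimono-≤ xk≤M') ⟩
        M - x k      ≡⟨ cong (_- x k) xi≡M ⟨
        x i - x k    ≤⟨ ≤nbrMax (λ j → x i - x j) i~k ⟩
        descent x i  ∎
      step : ∀ j → adj G i j ≡ true → x i ⊓ M' - x j ⊓ M' + (M - M') ≤ descent x i
      step j i~j = begin
        x i ⊓ M' - x j ⊓ M' + (M - M')  ≡⟨ cong (λ t → t ⊓ M' - x j ⊓ M' + (M - M')) xi≡M ⟩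
        M ⊓ M' - x j ⊓ M' + (M - M')    ≡⟨ cong (λ t → t - x j ⊓ M' + (M - M')) (p≥q⇒p⊓q≡q gap) ⟩
        M' - x j ⊓ M' + (M - M')        ≡⟨ q-r+[p-q]≡p-r M M' (x j ⊓ M') ⟩
        M - x j ⊓ M'                    ≡⟨ p-q⊓r≡p-q⊔p-r M (x j) M' ⟩
        (M - x j) ⊔ (M - M')            ≤⟨ ⊔-lub (subst (λ t → t - x j ≤ descent x i) xi≡M
                                                         (≤nbrMax (λ l → x i - x l) i~j))
                                                  gap≤descent ⟩
        descent x i                     ∎

    Σdescent-truncate : ∀ {x A M M'} → TopLevelSet x A M M' →
      Σ (descent (λ j → x j ⊓ M')) + (M - M') * fromℕ (card (∂int G A)) ≤ Σ (descent x)
    Σdescent-truncate {x} {A} {M} {M'} top = begin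
      Σ (descent y) + (M - M') * fromℕ (card (∂int G A))
        ≡⟨ sumMap-+-indicator (allFin n) (descent y) (∂int G A) (M - M') ⟨
      Σ (λ i → descent y i + (if ∂int G A i then M - M' else 0ℚ))
        ≤⟨ sumMap-mono-≤ (allFin n) (descent-truncate top) ⟩
      Σ (descent x) ∎
      where
      open ≤-Reasoning
      y = λ j → x j ⊓ M'

  -- The ℓ¹-spread and the coarea argument

  module _ {n : ℕ} where

    spread : (Fin n → ℚ) → ℚ → ℚ
    spread x c = Σ (λ i → ∣ x i - c ∣)

    Σ-two-valued : ∀ (p : Fin n → Bool) u w →
      Σ (λ i → if p i then u else w) ≡ u * fromℕ (card p) + w * fromℕ (card (λ i → not (p i)))
    Σ-two-valued p u w = begin
      Σ (λ i → if p i then u else w)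
        ≡⟨ sumMap-cong (allFin n) (λ i → split (p i)) ⟩
      Σ (λ i → (if p i then u else 0ℚ) + (if not (p i) then w else 0ℚ))
        ≡⟨ sumMap-+ (allFin n) _ _ ⟩
      Σ (λ i → if p i then u else 0ℚ) + Σ (λ i → if not (p i) then w else 0ℚ)
        ≡⟨ cong₂ _+_ (sumMap-indicator (allFin n) p u)
                     (sumMap-indicator (allFin n) (λ i → not (p i)) w) ⟩
      u * fromℕ (card p) + w * fromℕ (card (λ i → not (p i))) ∎
      where
      open ≡-Reasoning
      split : ∀ b → (if b then u else w) ≡ (if b then u else 0ℚ) + (if not b then w else 0ℚ)
      split true  = sym (+-identityʳ u)
      split false = sym (+-identityˡ w)

    norm1≤2spread : ∀ x c → inner1 x ≡ 0ℚ → norm1 x ≤ spread x c + spread x c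
    norm1≤2spread x c Σx≡0 = begin
      norm1 x                        ≤⟨ sumMap-mono-≤ (allFin n) triangle ⟩
      Σ (λ i → ∣ x i - c ∣ + ∣ c ∣)   ≡⟨ sumMap-+ (allFin n) _ _ ⟩
      spread x c + Σ {n} (λ _ → ∣ c ∣)  ≤⟨ +-monoʳ-≤ (spread x c) Σ∣c∣≤spread ⟩
      spread x c + spread x c        ∎
      where
      open ≤-Reasoning
      N = length (allFin n)
      triangle : ∀ i → ∣ x i ∣ ≤ ∣ x i - c ∣ + ∣ c ∣
      triangle i = subst₂ (λ s t → ∣ s ∣ ≤ ∣ x i - c ∣ + ∣ t ∣) (+-identityʳ (x i)) (+-identityʳ c)
                          (∣p-r∣≤∣p-q∣+∣q-r∣ (x i) c 0ℚ)
      Σ[c-x]≡c*N : Σ (λ i → c - x i) ≡ c * fromℕ N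
      Σ[c-x]≡c*N = trans (sumMap-+ (allFin n) (λ _ → c) (λ i → - x i))
        (trans (cong₂ _+_ (sumMap-const (allFin n) c) (trans (sumMap-neg (allFin n) x) (cong -_ Σx≡0)))
               (+-identityʳ (c * fromℕ N)))
      Σ∣c∣≤spread : Σ {n} (λ _ → ∣ c ∣) ≤ spread x c
      Σ∣c∣≤spread = begin
        Σ {n} (λ _ → ∣ c ∣)     ≡⟨ sumMap-const (allFin n) ∣ c ∣ ⟩
        ∣ c ∣ * fromℕ N         ≡⟨ cong (∣ c ∣ *_) (0≤p⇒∣p∣≡p (0≤fromℕ N)) ⟨
        ∣ c ∣ * ∣ fromℕ N ∣     ≡⟨ ∣p*q∣≡∣p∣*∣q∣ c (fromℕ N) ⟨
        ∣ c * fromℕ N ∣         ≡⟨ cong ∣_∣ Σ[c-x]≡c*N ⟨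
        ∣ Σ (λ i → c - x i) ∣   ≤⟨ ∣sumMap∣≤sumMap∣∣ (allFin n) _ ⟩
        Σ (λ i → ∣ c - x i ∣)   ≡⟨ sumMap-cong (allFin n) (λ i → ∣p-q∣≡∣q-p∣ c (x i)) ⟩
        spread x c              ∎

    spread-majority : ∀ y (A : VSet n) {v} → (∀ i → lookup A i ≡ true → y i ≡ v) →
      card (λ i → not (lookup A i)) ℕ.≤ card (lookup A) → ∀ c → spread y v ≤ spread y c
    spread-majority y A {v} onA Aᶜ≤A c = begin
      spread y v
        ≤⟨ sumMap-mono-≤ (allFin n) pointwise ⟩
      Σ (λ i → ∣ y i - c ∣ + (if lookup A i then - e else e))
        ≡⟨ sumMap-+ (allFin n) _ _ ⟩
      spread y c + Σ (λ i → if lookup A i then - e else e)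
        ≡⟨ cong (spread y c +_) (Σ-two-valued (lookup A) (- e) e) ⟩
      spread y c + (- e * fromℕ a + e * fromℕ b)
        ≤⟨ +-monoʳ-≤ (spread y c) balance ⟩
      spread y c + 0ℚ
        ≡⟨ +-identityʳ (spread y c) ⟩
      spread y c ∎
      where
      open ≤-Reasoning
      e = ∣ v - c ∣
      a = card (lookup A)
      b = card (λ i → not (lookup A i))
      balance : - e * fromℕ a + e * fromℕ b ≤ 0ℚ
      balance = begin
        - e * fromℕ a + e * fromℕ b   ≡⟨ -p*q+p*r≡p*[r-q] e (fromℕ a) (fromℕ b) ⟩
        e * (fromℕ b - fromℕ a)       ≤⟨ *-monoˡ-≤-0≤ (0≤∣p∣ (v - c))
                                                       (+-monoˡ-≤ (- fromℕ a) (fromℕ-mono-≤ Aᶜ≤A)) ⟩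
        e * (fromℕ a - fromℕ a)       ≡⟨ cong (e *_) (+-inverseʳ (fromℕ a)) ⟩
        e * 0ℚ                        ≡⟨ *-zeroʳ e ⟩
        0ℚ                            ∎
      pointwise : ∀ i → ∣ y i - v ∣ ≤ ∣ y i - c ∣ + (if lookup A i then - e else e)
      pointwise i with lookup A i in Ai
      ... | true = ≤-reflexive (begin-equality
        ∣ y i - v ∣        ≡⟨ cong (λ t → ∣ t - v ∣) (onA i Ai) ⟩
        ∣ v - v ∣          ≡⟨ ∣p-p∣≡0 v ⟩
        0ℚ                 ≡⟨ +-inverseʳ e ⟨
        e - e              ≡⟨ cong (λ t → ∣ t - c ∣ - e) (onA i Ai) ⟨
        ∣ y i - c ∣ - e    ∎)
      ... | false = begin
        ∣ y i - v ∣                ≤⟨ ∣p-r∣≤∣p-q∣+∣q-r∣ (y i) c v ⟩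
        ∣ y i - c ∣ + ∣ c - v ∣    ≡⟨ cong (∣ y i - c ∣ +_) (∣p-q∣≡∣q-p∣ c v) ⟩
        ∣ y i - c ∣ + e            ∎

    spread-truncate-≤ : ∀ {x A M M'} → TopLevelSet x A M M' →
      ∀ c → spread x c ≤ spread (λ j → x j ⊓ M') c + (M - M') * fromℕ (card (lookup A))
    spread-truncate-≤ {x} {A} {M} {M'} top c = begin
      spread x c
        ≤⟨ sumMap-mono-≤ (allFin n) pointwise ⟩
      Σ (λ i → ∣ y i - c ∣ + (if lookup A i then M - M' else 0ℚ))
        ≡⟨ sumMap-+-indicator (allFin n) (λ i → ∣ y i - c ∣) (lookup A) (M - M') ⟩
      spread y c + (M - M') * fromℕ (card (lookup A)) ∎
      where
      open ≤-Reasoning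
      open TopLevelSet top
      y = λ j → x j ⊓ M'
      pointwise : ∀ i → ∣ x i - c ∣ ≤ ∣ y i - c ∣ + (if lookup A i then M - M' else 0ℚ)
      pointwise i with lookup A i in Ai
      ... | true = begin
        ∣ x i - c ∣               ≡⟨ cong (λ t → ∣ t - c ∣) (on-top i Ai) ⟩
        ∣ M - c ∣                 ≤⟨ ∣p-r∣≤∣p-q∣+∣q-r∣ M M' c ⟩
        ∣ M - M' ∣ + ∣ M' - c ∣    ≡⟨ +-comm ∣ M - M' ∣ ∣ M' - c ∣ ⟩
        ∣ M' - c ∣ + ∣ M - M' ∣    ≡⟨ cong₂ (λ s t → ∣ s - c ∣ + t) (sym yi≡M')
                                           (0≤p⇒∣p∣≡p (p≤q⇒0≤q-p gap)) ⟩
        ∣ y i - c ∣ + (M - M')    ∎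
        where
        yi≡M' : y i ≡ M'
        yi≡M' = trans (cong (_⊓ M') (on-top i Ai)) (p≥q⇒p⊓q≡q gap)
      ... | false = begin
        ∣ x i - c ∣         ≡⟨ cong (λ t → ∣ t - c ∣) (p≤q⇒p⊓q≡p (below i Ai)) ⟨
        ∣ y i - c ∣         ≡⟨ +-identityʳ _ ⟨
        ∣ y i - c ∣ + 0ℚ    ∎

    spread-truncate-≡ : ∀ {x A M M'} → TopLevelSet x A M M' →
      spread x M ≡ spread (λ j → x j ⊓ M') M' + (M - M') * fromℕ (card (λ i → not (lookup A i)))
    spread-truncate-≡ {x} {A} {M} {M'} top = begin
      spread x M
        ≡⟨ sumMap-cong (allFin n) pointwise ⟩
      Σ (λ i → ∣ y i - M' ∣ + (if not (lookup A i) then M - M' else 0ℚ))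
        ≡⟨ sumMap-+-indicator (allFin n) (λ i → ∣ y i - M' ∣) (λ i → not (lookup A i)) (M - M') ⟩
      spread y M' + (M - M') * fromℕ (card (λ i → not (lookup A i))) ∎
      where
      open ≡-Reasoning
      open TopLevelSet top
      y = λ j → x j ⊓ M'
      pointwise : ∀ i → ∣ x i - M ∣ ≡ ∣ y i - M' ∣ + (if not (lookup A i) then M - M' else 0ℚ)
      pointwise i with lookup A i in Ai
      ... | true = begin
        ∣ x i - M ∣          ≡⟨ cong (λ t → ∣ t - M ∣) (on-top i Ai) ⟩
        ∣ M - M ∣            ≡⟨ ∣p-p∣≡0 M ⟩
        0ℚ                   ≡⟨ ∣p-p∣≡0 M' ⟨
        ∣ M' - M' ∣          ≡⟨ cong (λ t → ∣ t - M' ∣) (p≥q⇒p⊓q≡q gap) ⟨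
        ∣ M ⊓ M' - M' ∣      ≡⟨ cong (λ t → ∣ t ⊓ M' - M' ∣) (on-top i Ai) ⟨
        ∣ y i - M' ∣         ≡⟨ +-identityʳ _ ⟨
        ∣ y i - M' ∣ + 0ℚ    ∎
      ... | false = begin
        ∣ x i - M ∣                  ≡⟨ ∣p-q∣≡q-p (≤-trans (below i Ai) gap) ⟩
        M - x i                      ≡⟨ q-r+[p-q]≡p-r M M' (x i) ⟨
        M' - x i + (M - M')          ≡⟨ cong (_+ (M - M')) (∣p-q∣≡q-p (below i Ai)) ⟨
        ∣ x i - M' ∣ + (M - M')      ≡⟨ cong (λ t → ∣ t - M' ∣ + (M - M')) (p≤q⇒p⊓q≡p (below i Ai)) ⟨
        ∣ y i - M' ∣ + (M - M')      ∎

    -- If A is the larger side, M′ is a majority value of x ⊓ M′, and the centre moves up to M.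
    spread-truncate : ∀ {x A M M'} → TopLevelSet x A M M' →
      ∀ c → ∃[ c' ] spread x c' ≤ spread (λ j → x j ⊓ M') c + (M - M') * fromℕ (minSide A)
    spread-truncate {x} {A} {M} {M'} top c
      with ℕₚ.≤-total (card (lookup A)) (card (λ i → not (lookup A i)))
    ... | inj₁ A≤Aᶜ = c , (begin
      spread x c                                        ≤⟨ spread-truncate-≤ top c ⟩
      spread y c + (M - M') * fromℕ (card (lookup A))   ≡⟨ cong (λ m → spread y c + (M - M') * fromℕ m)
                                                                (ℕₚ.m≤n⇒m⊓n≡m A≤Aᶜ) ⟨
      spread y c + (M - M') * fromℕ (minSide A)         ∎)
      where
      open ≤-Reasoning
      y = λ j → x j ⊓ M'
    ... | inj₂ Aᶜ≤A = M , (begin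
      spread x M                                                        ≡⟨ spread-truncate-≡ top ⟩
      spread y M' + (M - M') * fromℕ (card (λ i → not (lookup A i)))
        ≤⟨ +-monoˡ-≤ _ (spread-majority y A yA≡M' Aᶜ≤A c) ⟩
      spread y c + (M - M') * fromℕ (card (λ i → not (lookup A i)))
        ≡⟨ cong (λ m → spread y c + (M - M') * fromℕ m) (ℕₚ.m≥n⇒m⊓n≡n Aᶜ≤A) ⟨
      spread y c + (M - M') * fromℕ (minSide A)                         ∎)
      where
      open ≤-Reasoning
      open TopLevelSet top
      y = λ j → x j ⊓ M'
      yA≡M' : ∀ i → lookup A i ≡ true → y i ≡ M'
      yA≡M' i Ai = trans (cong (_⊓ M') (on-top i Ai)) (p≥q⇒p⊓q≡q gap)

  module _ {n : ℕ} (G : Graph n) where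

    peel-step : ∀ {x A M M'} → TopLevelSet x A M M' → properNonempty A ≡ true →
      ∀ {c} → h-int G * spread (λ j → x j ⊓ M') c ≤ Σ (descent G (λ j → x j ⊓ M')) →
      ∃[ c' ] h-int G * spread x c' ≤ Σ (descent G x)
    peel-step {x} {A} {M} {M'} top pA {c} ih =
      let c' , spread≤ = spread-truncate top c in c' , (begin
        h * spread x c'
          ≤⟨ *-monoˡ-≤-0≤ (0≤cheeger (∂int G) A pA) spread≤ ⟩
        h * (spread y c + (M - M') * fromℕ (minSide A))
          ≡⟨ p*[q+r*s]≡p*q+r*[p*s] h (spread y c) (M - M') (fromℕ (minSide A)) ⟩
        h * spread y c + (M - M') * (h * fromℕ (minSide A))
          ≤⟨ +-mono-≤ ih (*-monoˡ-≤-0≤ (p≤q⇒0≤q-p gap) (cheeger-isoperimetric (∂int G) A pA)) ⟩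
        Σ (descent G y) + (M - M') * fromℕ (card (∂int G A))
          ≤⟨ Σdescent-truncate G top ⟩
        Σ (descent G x) ∎)
      where
      open ≤-Reasoning
      open TopLevelSet top
      h = h-int G
      y = λ j → x j ⊓ M'

    peel : ∀ x {M} → (∀ i → x i ≤ M) → ∀ k → x k ≡ M →
             Acc ℕ._<_ (card (λ i → does (x i <? M))) →
             ∃[ c ] h-int G * spread x c ≤ Σ (descent G x)
    peel x {M} x≤M k xk≡M (acc smaller) with any? (λ j → x j <? M)
    ... | no ∄x<M = M , (begin
      h-int G * spread x M  ≡⟨ cong (h-int G *_) flat ⟩
      h-int G * 0ℚ          ≡⟨ *-zeroʳ (h-int G) ⟩
      0ℚ                    ≤⟨ 0≤sumMap (allFin n) (λ i → 0≤nbrMax G i _) ⟩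
      Σ (descent G x)       ∎)
      where
      open ≤-Reasoning
      x≡M : ∀ i → x i ≡ M
      x≡M i = ≤-antisym (x≤M i) (≮⇒≥ (λ xi<M → ∄x<M (i , xi<M)))
      flat : spread x M ≡ 0ℚ
      flat = trans (sumMap-cong (allFin n) (λ i → trans (cong (λ t → ∣ t - M ∣) (x≡M i)) (∣p-p∣≡0 M)))
                   (trans (sumMap-const (allFin n) 0ℚ) (*-zeroˡ (fromℕ (length (allFin n)))))
    ... | yes (j , xj<M) =
      let k' , xk'<M , below≤M' = maximiser x (λ i → x i <? M) xj<M
          M' = x k'
      in peel-step (upperSet-topLevelSet x x≤M (<⇒≤ xk'<M) below≤M') (upperSet-proper x k j xk≡M xj<M)
           (proj₂ (peel (λ i → x i ⊓ M') (λ i → p⊓q≤q (x i) M') k' (⊓-idem M')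
                        (smaller (truncate-fewer-below x k' refl xk'<M))))

    h-int*spread≤Σdescent : Fin n → ∀ x → ∃[ c ] h-int G * spread x c ≤ Σ (descent G x)
    h-int*spread≤Σdescent k₀ x =
      let k , _ , x≤xk = maximiser x (λ _ → yes tt) {k₀} tt
      in peel x (λ i → x≤xk i tt) k refl (<-wellFounded _)

    P1-lower-bound : 2 ℕ.≤ n → ∀ x → inner1 x ≡ 0ℚ →
                     ½ * (h-int G ⊔ h-ext G) * norm1 x ≤ P1num G x
    P1-lower-bound 2≤n x Σx≡0 = begin
      ½ * (h-int G ⊔ h-ext G) * norm1 x
        ≡⟨ cong (λ h → ½ * h * norm1 x) (p≥q⇒p⊔q≡p (h-ext≤h-int G A₀ pA₀)) ⟩
      ½ * h-int G * norm1 x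
        ≤⟨ *-monoˡ-≤-0≤ (0≤p*q (nonNegative⁻¹ ½) (0≤cheeger (∂int G) A₀ pA₀))
                        (norm1≤2spread x c Σx≡0) ⟩
      ½ * h-int G * (spread x c + spread x c)
        ≡⟨ ½*p*[q+q]≡p*q (h-int G) (spread x c) ⟩
      h-int G * spread x c
        ≤⟨ spread≤ ⟩
      Σ (descent G x)
        ≤⟨ sumMap-mono-≤ (allFin n) (descent≤maxNbr G x) ⟩
      P1num G x ∎
      where
      open ≤-Reasoning
      A₀ = proj₁ (properSubset 2≤n)
      pA₀ = proj₂ (properSubset 2≤n)
      k₀ = proj₁ (member A₀ pA₀)
      c = proj₁ (h-int*spread≤Σdescent k₀ x)
      spread≤ = proj₂ (h-int*spread≤Σdescent k₀ x)

  -- A two-valued test vector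

  [b+a]*v≤h*[b*a+a*b] : ∀ h a b {v} → h * fromℕ (a ℕ.⊓ b) ≡ fromℕ v →
    (fromℕ b + fromℕ a) * fromℕ v ≤ h * (fromℕ b * fromℕ a + fromℕ a * fromℕ b)
  [b+a]*v≤h*[b*a+a*b] h a b {v} h*min≡v with ℕₚ.≤-total a b
  ... | inj₁ a≤b = begin
    (fromℕ b + fromℕ a) * fromℕ v
      ≤⟨ *-monoʳ-≤-0≤ (0≤fromℕ v) (+-monoʳ-≤ (fromℕ b) (fromℕ-mono-≤ a≤b)) ⟩
    (fromℕ b + fromℕ b) * fromℕ v
      ≡⟨ cong ((fromℕ b + fromℕ b) *_) h*min≡v ⟨
    (fromℕ b + fromℕ b) * (h * fromℕ (a ℕ.⊓ b))
      ≡⟨ cong (λ m → (fromℕ b + fromℕ b) * (h * fromℕ m)) (ℕₚ.m≤n⇒m⊓n≡m a≤b) ⟩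
    (fromℕ b + fromℕ b) * (h * fromℕ a)
      ≡⟨ identity h (fromℕ a) (fromℕ b) ⟩
    h * (fromℕ b * fromℕ a + fromℕ a * fromℕ b) ∎
    where
    open ≤-Reasoning
    identity : ∀ h p q → (q + q) * (h * p) ≡ h * (q * p + p * q)
    identity = solve-∀ ℚ-ring
  ... | inj₂ b≤a = begin
    (fromℕ b + fromℕ a) * fromℕ v
      ≤⟨ *-monoʳ-≤-0≤ (0≤fromℕ v) (+-monoˡ-≤ (fromℕ a) (fromℕ-mono-≤ b≤a)) ⟩
    (fromℕ a + fromℕ a) * fromℕ v
      ≡⟨ cong ((fromℕ a + fromℕ a) *_) h*min≡v ⟨
    (fromℕ a + fromℕ a) * (h * fromℕ (a ℕ.⊓ b))
      ≡⟨ cong (λ m → (fromℕ a + fromℕ a) * (h * fromℕ m)) (ℕₚ.m≥n⇒m⊓n≡n b≤a) ⟩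
    (fromℕ a + fromℕ a) * (h * fromℕ b)
      ≡⟨ identity h (fromℕ a) (fromℕ b) ⟩
    h * (fromℕ b * fromℕ a + fromℕ a * fromℕ b) ∎
    where
    open ≤-Reasoning
    identity : ∀ h p q → (p + p) * (h * q) ≡ h * (q * p + p * q)
    identity = solve-∀ ℚ-ring

  module _ {n : ℕ} where

    0≤norm1 : ∀ x → 0ℚ ≤ norm1 x
    0≤norm1 x = 0≤sumMap (allFin n) (λ i → 0≤∣p∣ (x i))

    norm1-two-valued : ∀ (A : VSet n) u w → norm1 (λ i → if lookup A i then u else w) ≡
                       ∣ u ∣ * fromℕ (card (lookup A)) + ∣ w ∣ * fromℕ (card (λ i → not (lookup A i)))
    norm1-two-valued A u w =
      trans (sumMap-cong (allFin n) (λ i → if-float ∣_∣ (lookup A i)))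
            (Σ-two-valued (lookup A) ∣ u ∣ ∣ w ∣)

  module _ {n : ℕ} (G : Graph n) where

    maxNbr-two-valued : ∀ A u w i →
      maxNbr G (λ j → if lookup A j then u else w) i ≤ (if ∂ver G A i then ∣ u - w ∣ else 0ℚ)
    maxNbr-two-valued A u w i = nbrMax-lub G i _ 0≤bound jump
      where
      bound = if ∂ver G A i then ∣ u - w ∣ else 0ℚ
      0≤bound : 0ℚ ≤ bound
      0≤bound with ∂ver G A i
      ... | true  = 0≤∣p∣ (u - w)
      ... | false = ≤-refl
      ∂ver≡true : ∂ext G A i ≡ true ⊎ ∂int G A i ≡ true → bound ≡ ∣ u - w ∣
      ∂ver≡true (inj₁ ∂ext≡true) = cong (if_then ∣ u - w ∣ else 0ℚ) (cong (_∨ ∂int G A i) ∂ext≡true)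
      ∂ver≡true (inj₂ ∂int≡true) = cong (if_then ∣ u - w ∣ else 0ℚ)
                                       (trans (cong (∂ext G A i ∨_) ∂int≡true) (∨-zeroʳ (∂ext G A i)))
      jump : ∀ j → adj G i j ≡ true →
             ∣ (if lookup A i then u else w) - (if lookup A j then u else w) ∣ ≤ bound
      jump j i~j = across (lookup A i) (lookup A j) refl refl
        where
        across : ∀ α β → lookup A i ≡ α → lookup A j ≡ β →
                 ∣ (if α then u else w) - (if β then u else w) ∣ ≤ bound
        across true  true  _  _  = ≤-trans (≤-reflexive (∣p-p∣≡0 u)) 0≤bound
        across false false _  _  = ≤-trans (≤-reflexive (∣p-p∣≡0 w)) 0≤bound
        across true  false Ai Aj = ≤-reflexive (sym (∂ver≡true (inj₂
          (cong₂ _∧_ Ai (anyV-intro j (cong₂ _∧_ (cong not Aj) i~j))))))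
        across false true  Ai Aj = ≤-reflexive (trans (∣p-q∣≡∣q-p∣ w u) (sym (∂ver≡true (inj₁
          (cong₂ _∧_ (cong not Ai) (anyV-intro j (cong₂ _∧_ Aj i~j)))))))

    P1num-two-valued : ∀ A u w →
      P1num G (λ j → if lookup A j then u else w) ≤ ∣ u - w ∣ * fromℕ (card (∂ver G A))
    P1num-two-valued A u w = ≤-trans (sumMap-mono-≤ (allFin n) (maxNbr-two-valued A u w))
      (≤-reflexive (sumMap-indicator (allFin n) (∂ver G A) ∣ u - w ∣))

    P1-upper-bound : 2 ℕ.≤ n →
      Σ[ x ∈ (Fin n → ℚ) ] (¬ (∀ i → x i ≡ 0ℚ)) × (inner1 x ≡ 0ℚ) × (P1num G x ≤ h-ver G * norm1 x)
    P1-upper-bound 2≤n = x , x≢0 , Σx≡0 , (begin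
      P1num G x                                     ≤⟨ P1num-two-valued A (fromℕ b) (- fromℕ a) ⟩
      ∣ fromℕ b - - fromℕ a ∣ * fromℕ v              ≡⟨ cong (_* fromℕ v) jump≡ ⟩
      (fromℕ b + fromℕ a) * fromℕ v                  ≤⟨ [b+a]*v≤h*[b*a+a*b] h a b {v} h*minSide≡v ⟩
      h * (fromℕ b * fromℕ a + fromℕ a * fromℕ b)    ≡⟨ cong (h *_) norm1x≡ ⟨
      h * norm1 x                                   ∎)
      where
      open ≤-Reasoning
      h = h-ver G
      attained = cheeger-attained (∂ver G) (proj₁ (properSubset 2≤n)) (proj₂ (properSubset 2≤n))
      A = proj₁ attained
      pA = proj₁ (proj₂ attained)
      a = card (lookup A)
      b = card (λ i → not (lookup A i))
      v = card (∂ver G A)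
      x : Fin n → ℚ
      x i = if lookup A i then fromℕ b else - fromℕ a
      h*minSide≡v : h * fromℕ (a ℕ.⊓ b) ≡ fromℕ v
      h*minSide≡v = trans (cong (_* fromℕ (minSide A)) (proj₂ (proj₂ attained)))
                          (frac-* v (1≤minSide A pA))
      x≢0 : ¬ (∀ i → x i ≡ 0ℚ)
      x≢0 x≡0 =
        let i , Ai = member A pA
            j , Aj = nonMember A pA
        in <-irrefl (sym (trans (cong (if_then fromℕ b else - fromℕ a) (sym Ai)) (x≡0 i)))
                    (0<fromℕ (1≤card {p = λ k → not (lookup A k)} j (cong not Aj)))
      Σx≡0 : inner1 x ≡ 0ℚ
      Σx≡0 = trans (Σ-two-valued (lookup A) (fromℕ b) (- fromℕ a)) (p*q+-q*p≡0 (fromℕ b) (fromℕ a))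
      jump≡ : ∣ fromℕ b - - fromℕ a ∣ ≡ fromℕ b + fromℕ a
      jump≡ = trans (cong ∣_∣ (p--q≡p+q (fromℕ b) (fromℕ a)))
                    (0≤p⇒∣p∣≡p (+-mono-≤ (0≤fromℕ b) (0≤fromℕ a)))
      norm1x≡ : norm1 x ≡ fromℕ b * fromℕ a + fromℕ a * fromℕ b
      norm1x≡ = trans (norm1-two-valued A (fromℕ b) (- fromℕ a))
        (cong₂ (λ s t → s * fromℕ a + t * fromℕ b) (0≤p⇒∣p∣≡p (0≤fromℕ b))
               (trans (∣-p∣≡∣p∣ (fromℕ a)) (0≤p⇒∣p∣≡p (0≤fromℕ a))))

open import Data.Nat using (ℕ; _≤_)
open import Data.Fin using (Fin)
open import Data.Product using (Σ-syntax; _×_; _,_)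
open import Data.Rational using (ℚ; 0ℚ; ½; _+_; _*_; _⊔_; _<_)
open import Relation.Binary.PropositionalEquality using (_≡_)
open import Relation.Nullary using (¬_)

proposition4p5 : (n : ℕ) → 2 ≤ n → (G : Graph n) →
    ((x : Fin n → ℚ) → ¬ (∀ i → x i ≡ 0ℚ) → inner1 x ≡ 0ℚ →
      (½ * (h-int G ⊔ h-ext G)) * norm1 x Data.Rational.≤ P1num G x)
    ×
    ((ε : ℚ) → 0ℚ < ε →
      Σ[ x ∈ (Fin n → ℚ) ] (¬ (∀ i → x i ≡ 0ℚ)) × (inner1 x ≡ 0ℚ) ×
        (P1num G x Data.Rational.≤ (h-ver G + ε) * norm1 x))
proposition4p5 n 2≤n G =
  (λ x _ → P1-lower-bound G 2≤n x) ,
  (λ ε 0<ε → let x , x≢0 , Σx≡0 , P1num≤ = P1-upper-bound G 2≤n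
             in x , x≢0 , Σx≡0 , p≤h*q⇒p≤[h+ε]*q (h-ver G) (0≤norm1 x) 0<ε P1num≤)
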